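{- 1. Let $M,N\in$ dCBN. Then $M^n\{N^n/x\}=(M\{N/x\})^n$. 2. Let $M,N\in$ dCBV. If $N^v={!}P$, then $(M\{N/x\})^v=M^v\{P/x\}$.
   Context: $\{\cdot/x\}$ denotes meta-level (capture-avoiding) substitution. Translations into dBang (terms $M ::= x \mid \lambda x M \mid MN \mid {!}M \mid \mathrm{der}(M) \mid M[N/x]$): $x^n=x$, $(\lambda xM)^n=\lambda xM^n$, $(MN)^n=M^n\,{!}N^n$, $(M[N/x])^n=M^n[{!}N^n/x]$; $x^v={!}x$, $(\lambda xM)^v={!}(\lambda xM^v)$, $(MN)^v=L\langle P\rangle N^v$ if $M^v=L\langle{!}P\rangle$ (with $L::=\square\mid L[N/x]$) and $\mathrm{der}(M^v)N^v$ otherwise, $(M[N/x])^v=M^v[N^v/x]$. -}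

module Defs where

open import Data.Nat using (ℕ; zero; suc)
open import Data.Fin using (Fin; zero; suc)
open import Data.Maybe using (Maybe; just; nothing)

-- Binders (λ and explicit substitution M[N/x]) bind the variable `zero`
-- in their body, which lives in scope (suc n).

-- Source calculus (dCBN and dCBV share this syntax):
--   M ::= x | λx M | M N | M[N/x]
data Λ (n : ℕ) : Set where
  var  : Fin n → Λ n
  lam  : Λ (suc n) → Λ n
  app  : Λ n → Λ n → Λ n
  esub : Λ (suc n) → Λ n → Λ n

data D (n : ℕ) : Set where
  var  : Fin n → D n
  lam  : D (suc n) → D n
  app  : D n → D n → D n
  bang : D n → D n
  der  : D n → D n
  esub : D (suc n) → D n → D n

Ren : ℕ → ℕ → Set
Ren m n = Fin m → Fin n

extR : ∀ {m n} → Ren m n → Ren (suc m) (suc n)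
extR ρ zero    = zero
extR ρ (suc i) = suc (ρ i)

renΛ : ∀ {m n} → Ren m n → Λ m → Λ n
renΛ ρ (var i)    = var (ρ i)
renΛ ρ (lam M)    = lam (renΛ (extR ρ) M)
renΛ ρ (app M N)  = app (renΛ ρ M) (renΛ ρ N)
renΛ ρ (esub M N) = esub (renΛ (extR ρ) M) (renΛ ρ N)

extSΛ : ∀ {m n} → (Fin m → Λ n) → Fin (suc m) → Λ (suc n)
extSΛ σ zero    = var zero
extSΛ σ (suc i) = renΛ suc (σ i)

subΛ : ∀ {m n} → (Fin m → Λ n) → Λ m → Λ n
subΛ σ (var i)    = σ i
subΛ σ (lam M)    = lam (subΛ (extSΛ σ) M)
subΛ σ (app M N)  = app (subΛ σ M) (subΛ σ N)
subΛ σ (esub M N) = esub (subΛ (extSΛ σ) M) (subΛ σ N)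

-- M{N/x}, x the bound (zero-th) variable of M
_⟦_⟧Λ : ∀ {n} → Λ (suc n) → Λ n → Λ n
M ⟦ N ⟧Λ = subΛ σ M
  where
  σ : Fin (suc _) → Λ _
  σ zero    = N
  σ (suc i) = var i

renD : ∀ {m n} → Ren m n → D m → D n
renD ρ (var i)    = var (ρ i)
renD ρ (lam M)    = lam (renD (extR ρ) M)
renD ρ (app M N)  = app (renD ρ M) (renD ρ N)
renD ρ (bang M)   = bang (renD ρ M)
renD ρ (der M)    = der (renD ρ M)
renD ρ (esub M N) = esub (renD (extR ρ) M) (renD ρ N)

extSD : ∀ {m n} → (Fin m → D n) → Fin (suc m) → D (suc n)
extSD σ zero    = var zero
extSD σ (suc i) = renD suc (σ i)

subD : ∀ {m n} → (Fin m → D n) → D m → D n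
subD σ (var i)    = σ i
subD σ (lam M)    = lam (subD (extSD σ) M)
subD σ (app M N)  = app (subD σ M) (subD σ N)
subD σ (bang M)   = bang (subD σ M)
subD σ (der M)    = der (subD σ M)
subD σ (esub M N) = esub (subD (extSD σ) M) (subD σ N)

_⟦_⟧D : ∀ {n} → D (suc n) → D n → D n
M ⟦ N ⟧D = subD σ M
  where
  σ : Fin (suc _) → D _
  σ zero    = N
  σ (suc i) = var i

cbn : ∀ {n} → Λ n → D n
cbn (var i)    = var i
cbn (lam M)    = lam (cbn M)
cbn (app M N)  = app (cbn M) (bang (cbn N))
cbn (esub M N) = esub (cbn M) (bang (cbn N))

-- peel T = just L⟨P⟩  iff  T = L⟨!P⟩ with L ::= □ | L[N/x]; nothing otherwise.
peel : ∀ {n} → D n → Maybe (D n)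
peel (bang P)   = just P
peel (esub M Q) with peel M
... | just M′ = just (esub M′ Q)
... | nothing = nothing
peel _ = nothing

appV : ∀ {n} → D n → D n → D n
appV Mv Nv with peel Mv
... | just LP = app LP Nv
... | nothing = app (der Mv) Nv

cbv : ∀ {n} → Λ n → D n
cbv (var i)    = bang (var i)
cbv (lam M)    = bang (lam (cbv M))
cbv (app M N)  = appV (cbv M) (cbv N)
cbv (esub M N) = esub (cbv M) (cbv N)

{-# OPTIONS --safe #-}
-- Both translations commute with renamings, and with substitutions whose
-- images are translated pointwise; the theorem is the case of the singleton
-- substitution.  The CBV clause for application inspects whether M^v has the
-- shape L⟨!P⟩; a renaming cannot change that, and neither can a substitution
-- of CBV terms, because no CBV translation has a variable in the hole of L.
module Submission where

open import Defs
open import Data.Nat using (ℕ; suc)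
open import Data.Fin using (Fin; zero; suc)
open import Data.Maybe using (just; nothing)
import Data.Maybe as Maybe
open import Data.Product using (_×_; _,_)
open import Function using (_∘_)
open import Relation.Binary.PropositionalEquality

cbn-ren : ∀ {m n} (ρ : Ren m n) (M : Λ m) → cbn (renΛ ρ M) ≡ renD ρ (cbn M)
cbn-ren ρ (var i)    = refl
cbn-ren ρ (lam M)    = cong lam (cbn-ren (extR ρ) M)
cbn-ren ρ (app M N)  = cong₂ (λ M′ N′ → app M′ (bang N′)) (cbn-ren ρ M) (cbn-ren ρ N)
cbn-ren ρ (esub M N) = cong₂ (λ M′ N′ → esub M′ (bang N′)) (cbn-ren (extR ρ) M) (cbn-ren ρ N)

cbn-extS : ∀ {m n} {σ : Fin m → Λ n} {τ : Fin m → D n} →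
           cbn ∘ σ ≗ τ → cbn ∘ extSΛ σ ≗ extSD τ
cbn-extS         h zero    = refl
cbn-extS {σ = σ} h (suc i) = trans (cbn-ren suc (σ i)) (cong (renD suc) (h i))

cbn-sub : ∀ {m n} {σ : Fin m → Λ n} {τ : Fin m → D n} →
          cbn ∘ σ ≗ τ → ∀ M → cbn (subΛ σ M) ≡ subD τ (cbn M)
cbn-sub h (var i)    = h i
cbn-sub h (lam M)    = cong lam (cbn-sub (cbn-extS h) M)
cbn-sub h (app M N)  = cong₂ (λ M′ N′ → app M′ (bang N′)) (cbn-sub h M) (cbn-sub h N)
cbn-sub h (esub M N) = cong₂ (λ M′ N′ → esub M′ (bang N′)) (cbn-sub (cbn-extS h) M) (cbn-sub h N)

peel-ren : ∀ {m n} (ρ : Ren m n) (M : D m) → peel (renD ρ M) ≡ Maybe.map (renD ρ) (peel M)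
peel-ren ρ (var i)    = refl
peel-ren ρ (lam M)    = refl
peel-ren ρ (app M N)  = refl
peel-ren ρ (bang M)   = refl
peel-ren ρ (der M)    = refl
peel-ren ρ (esub M N) with peel (renD (extR ρ) M) | peel M | peel-ren (extR ρ) M
... | _ | just _  | refl = refl
... | _ | nothing | refl = refl

peel-sub-cbv : ∀ {m n} (τ : Fin m → D n) (M : Λ m) →
               peel (subD τ (cbv M)) ≡ Maybe.map (subD τ) (peel (cbv M))
peel-sub-cbv τ (var i)    = refl
peel-sub-cbv τ (lam M)    = refl
peel-sub-cbv τ (app M N)  with peel (cbv M)
... | just _  = refl
... | nothing = refl
peel-sub-cbv τ (esub M N) with peel (subD (extSD τ) (cbv M)) | peel (cbv M) | peel-sub-cbv (extSD τ) M
... | _ | just _  | refl = refl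
... | _ | nothing | refl = refl

appV-natural : ∀ {m n} (f : D m → D n) →
               (∀ M N → f (app M N) ≡ app (f M) (f N)) → (∀ M → f (der M) ≡ der (f M)) →
               ∀ M N → peel (f M) ≡ Maybe.map f (peel M) → appV (f M) (f N) ≡ f (appV M N)
appV-natural f f-app f-der M N peel-f with peel (f M) | peel M | peel-f
... | _ | just P  | refl = sym (f-app P N)
... | _ | nothing | refl = trans (cong (λ M′ → app M′ (f N)) (sym (f-der M))) (sym (f-app (der M) N))

cbv-ren : ∀ {m n} (ρ : Ren m n) (M : Λ m) → cbv (renΛ ρ M) ≡ renD ρ (cbv M)
cbv-ren ρ (var i)    = refl
cbv-ren ρ (lam M)    = cong (bang ∘ lam) (cbv-ren (extR ρ) M)
cbv-ren ρ (app M N)  =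
  trans (cong₂ appV (cbv-ren ρ M) (cbv-ren ρ N))
        (appV-natural (renD ρ) (λ _ _ → refl) (λ _ → refl) (cbv M) (cbv N) (peel-ren ρ (cbv M)))
cbv-ren ρ (esub M N) = cong₂ esub (cbv-ren (extR ρ) M) (cbv-ren ρ N)

cbv-extS : ∀ {m n} {σ : Fin m → Λ n} {τ : Fin m → D n} →
           cbv ∘ σ ≗ bang ∘ τ → cbv ∘ extSΛ σ ≗ bang ∘ extSD τ
cbv-extS         h zero    = refl
cbv-extS {σ = σ} h (suc i) = trans (cbv-ren suc (σ i)) (cong (renD suc) (h i))

cbv-sub : ∀ {m n} {σ : Fin m → Λ n} {τ : Fin m → D n} →
          cbv ∘ σ ≗ bang ∘ τ → ∀ M → cbv (subΛ σ M) ≡ subD τ (cbv M)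
cbv-sub         h (var i)    = h i
cbv-sub         h (lam M)    = cong (bang ∘ lam) (cbv-sub (cbv-extS h) M)
cbv-sub {τ = τ} h (app M N)  =
  trans (cong₂ appV (cbv-sub h M) (cbv-sub h N))
        (appV-natural (subD τ) (λ _ _ → refl) (λ _ → refl) (cbv M) (cbv N) (peel-sub-cbv τ M))
cbv-sub         h (esub M N) = cong₂ esub (cbv-sub (cbv-extS h) M) (cbv-sub h N)

mainTheorem11 :
    (∀ {n : ℕ} (M : Λ (suc n)) (N : Λ n) →
       (cbn M) ⟦ cbn N ⟧D ≡ cbn (M ⟦ N ⟧Λ))
    ×
    (∀ {n : ℕ} (M : Λ (suc n)) (N : Λ n) (P : D n) →
       cbv N ≡ bang P → cbv (M ⟦ N ⟧Λ) ≡ (cbv M) ⟦ P ⟧D)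
mainTheorem11 =
  (λ M N → sym (cbn-sub (λ { zero → refl ; (suc i) → refl }) M)) ,
  (λ M N P N≡!P → cbv-sub (λ { zero → N≡!P ; (suc i) → refl }) M)
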